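{- Let $G$ be a homogeneous $m$-generic $L$-graph and let $\Lambda$ be the set of all $C_{01}$-cover sets contained in $O(G)$ having exactly $|C_{01}|$ members. If for each $\mathcal{A}\in\Lambda$ there are distinct $k,l\in\{2,\dots,m-1\}$ and a $C_{01}^{kl}$-omission set in $O(G)$ based on $\mathcal{A}$, then the same holds for every $C_{01}$-cover set contained in $O(G)$.
   Context: A language $L$ for coloured $m$-partite graphs specifies, for each pair of distinct $i,j\in\{0,\dots,m-1\}$, a finite nonempty set of colours $C_{ij}=C_{ji}$. An $L$-graph has vertex set partitioned into parts $V_0,\dots,V_{m-1}$ (no edges inside parts) with a colour $F(x,y)=F(y,x)\in C_{ij}$ for $x\in V_i,y\in V_j$, $i\ne j$. Substructures are induced subgraphs; embeddings are injective, part- and colour-preserving. $G$ is homogeneous if every isomorphism between finite induced subgraphs extends to an automorphism. $G$ is $m$-generic if every part is countably infinite and for all distinct $i,j$, finite $U\subseteq V_i$ and $f:U\to C_{ij}$ there is $x\in V_j$ with $F(x,u)=f(u)$ for all $u\in U$. $O(G)$ is the class of finite $L$-graphs not embeddable in $G$ all of whose proper induced subgraphs embed in $G$. A monic is a finite $L$-graph with at most one vertex in each part; an $ijk$-triangle has exactly one vertex in each of $V_i,V_j,V_k$ and none elsewhere. For a monic $A$ with vertices in $V_i,V_j$, $F_A(E_{ij})$ is the colour of its $E_{ij}$-edge. A $C_{ij}$-cover set is a set of monics such that for each $c\in C_{ij}$ some member has $E_{ij}$-edge coloured $c$. A $C_{ij}^{kl}$-omission set is a $C_{ij}$-cover set of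 $ijk$- and $ijl$-triangles with colours $c_{ik},c_{il},c_{jk},c_{jl}$ such that every $ijk$-triangle in it has $E_{ik},E_{jk}$-edges coloured $c_{ik},c_{jk}$ and every $ijl$-triangle in it has $E_{il},E_{jl}$-edges coloured $c_{il},c_{jl}$. It is based on a $C_{ij}$-cover set $\mathcal{A}$ if there are (not necessarily distinct) $A,A'\in\mathcal{A}$ with $A$ having vertices in $V_i,V_j,V_k$, $F_A(E_{ik})=c_{ik}$, $F_A(E_{jk})=c_{jk}$, and $A'$ having vertices in $V_i,V_j,V_l$, $F_{A'}(E_{il})=c_{il}$, $F_{A'}(E_{jl})=c_{jl}$. -}

module Defs where

open import Data.Nat using (ℕ; zero; suc; _<_; _≤_)
open import Data.Fin using (Fin; zero; suc)
open import Data.Product using (Σ; ∃; ∃-syntax; _×_; _,_)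
open import Data.Sum using (_⊎_)
open import Data.List using (List)
open import Data.List.Membership.Propositional using (_∈_)
open import Relation.Binary.PropositionalEquality using (_≡_; _≢_)
open import Relation.Nullary using (¬_)
open import Function.Bundles using (_↔_; Inverse)
open import Function.Definitions using (Injective)

-- A language for coloured m-partite graphs.  The colour set C_ij is
-- represented as {c ∈ ℕ | c < sz i j}; symmetric (C_ij = C_ji),
-- finite, and nonempty for i ≢ j.
record Lang (m : ℕ) : Set where
  field
    sz     : Fin m → Fin m → ℕ
    sz-sym : ∀ i j → sz i j ≡ sz j i
    sz-pos : ∀ i j → i ≢ j → 1 ≤ sz i j

module _ {m : ℕ} (L : Lang m) where
  open Lang L

  -- An L-graph.  F x y is only meaningful when part x ≢ part y
  -- (no edges inside parts); its value on same-part pairs is ignored.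
  record LGraph : Set₁ where
    field
      V     : Set
      part  : V → Fin m
      F     : V → V → ℕ
      F-sym : ∀ x y → part x ≢ part y → F x y ≡ F y x
      F-col : ∀ x y → part x ≢ part y → F x y < sz (part x) (part y)

  record FinLGraph : Set where
    field
      n     : ℕ
      part  : Fin n → Fin m
      F     : Fin n → Fin n → ℕ
      F-sym : ∀ x y → part x ≢ part y → F x y ≡ F y x
      F-col : ∀ x y → part x ≢ part y → F x y < sz (part x) (part y)

  toLGraph : FinLGraph → LGraph
  toLGraph A = record
    { V = Fin n ; part = part ; F = F ; F-sym = F-sym ; F-col = F-col }
    where open FinLGraph A

  restrict : (A : FinLGraph) (k : ℕ) → (Fin k → Fin (FinLGraph.n A)) → FinLGraph
  restrict A k h = record
    { n = k
    ; part = λ x → part (h x)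
    ; F = λ x y → F (h x) (h y)
    ; F-sym = λ x y → F-sym (h x) (h y)
    ; F-col = λ x y → F-col (h x) (h y) }
    where open FinLGraph A

  Embeds : LGraph → LGraph → Set
  Embeds G H =
    Σ (G.V → H.V) λ f →
      Injective _≡_ _≡_ f
      × (∀ x → H.part (f x) ≡ G.part x)
      × (∀ x y → G.part x ≢ G.part y → H.F (f x) (f y) ≡ G.F x y)
    where module G = LGraph G
          module H = LGraph H

  -- homogeneity: every isomorphism between finite induced subgraphs
  -- (the iso u a ↦ w a between the images of u and w) extends to an
  -- automorphism.
  Homogeneous : LGraph → Set
  Homogeneous G =
    ∀ (k : ℕ) (u w : Fin k → V) →
      Injective _≡_ _≡_ u → Injective _≡_ _≡_ w →
      (∀ a → part (w a) ≡ part (u a)) →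
      (∀ a b → part (u a) ≢ part (u b) → F (w a) (w b) ≡ F (u a) (u b)) →
      Σ (V ↔ V) λ σ →
        (∀ x → part (Inverse.to σ x) ≡ part x)
        × (∀ x y → part x ≢ part y → F (Inverse.to σ x) (Inverse.to σ y) ≡ F x y)
        × (∀ a → Inverse.to σ (u a) ≡ w a)
    where open LGraph G

  Generic : LGraph → Set
  Generic G =
    (∀ (i : Fin m) → Σ V (λ x → part x ≡ i) ↔ ℕ)
    × (∀ (i j : Fin m) → i ≢ j →
        ∀ (U : List V) → (∀ u → u ∈ U → part u ≡ i) →
        ∀ (f : V → ℕ) → (∀ u → u ∈ U → f u < sz i j) →
        ∃[ x ] (part x ≡ j × (∀ u → u ∈ U → F x u ≡ f u)))
    where open LGraph G

  InO : LGraph → FinLGraph → Set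
  InO G A =
    ¬ Embeds (toLGraph A) G
    × (∀ (k : ℕ) (h : Fin k → Fin (FinLGraph.n A)) → Injective _≡_ _≡_ h →
         k < FinLGraph.n A → Embeds (toLGraph (restrict A k h)) G)

  module _ (A : FinLGraph) where
    open FinLGraph A

    Monic : Set
    Monic = ∀ x y → part x ≡ part y → x ≡ y

    HasEdge : Fin m → Fin m → ℕ → Set
    HasEdge i j c = ∃[ x ] ∃[ y ] (part x ≡ i × part y ≡ j × F x y ≡ c)

    Triangle : Fin m → Fin m → Fin m → Set
    Triangle i j k =
      Monic
      × (∀ x → part x ≡ i ⊎ part x ≡ j ⊎ part x ≡ k)
      × (∃[ x ] part x ≡ i) × (∃[ x ] part x ≡ j) × (∃[ x ] part x ≡ k)

  -- a set of monics, given as a family indexed by I, is a C_ij-cover set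
  CoverSet : Fin m → Fin m → {I : Set} → (I → FinLGraph) → Set
  CoverSet i j {I} 𝒜 =
    (∀ a → Monic (𝒜 a)) × (∀ c → c < sz i j → ∃[ a ] HasEdge (𝒜 a) i j c)

  OmissionSet : (i j k l : Fin m) (cik cil cjk cjl : ℕ) →
                {J : Set} → (J → FinLGraph) → Set
  OmissionSet i j k l cik cil cjk cjl 𝒪 =
    CoverSet i j 𝒪
    × cik < sz i k × cil < sz i l × cjk < sz j k × cjl < sz j l
    × (∀ b → (Triangle (𝒪 b) i j k × HasEdge (𝒪 b) i k cik × HasEdge (𝒪 b) j k cjk)
           ⊎ (Triangle (𝒪 b) i j l × HasEdge (𝒪 b) i l cil × HasEdge (𝒪 b) j l cjl))

  BasedOn : (i j k l : Fin m) (cik cil cjk cjl : ℕ) → {I : Set} → (I → FinLGraph) → Set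
  BasedOn i j k l cik cil cjk cjl 𝒜 =
    (∃[ a ] (HasEdge (𝒜 a) i k cik × HasEdge (𝒜 a) j k cjk))
    × (∃[ a' ] (HasEdge (𝒜 a') i l cil × HasEdge (𝒜 a') j l cjl))

-- parts are Fin (2 + m'); 0 and 1 are zero and suc zero; indices
-- k ∈ {2,…,m-1} are suc (suc k') for k' : Fin m'.
module _ {m' : ℕ} (L : Lang (suc (suc m'))) where

  HasOmission : LGraph L → {I : Set} → (I → FinLGraph L) → Set₁
  HasOmission G 𝒜 =
    ∃[ k ] ∃[ l ] (k ≢ l ×
      ∃[ c0k ] ∃[ c0l ] ∃[ c1k ] ∃[ c1l ]
        Σ Set λ J → Σ (J → FinLGraph L) λ 𝒪 →
          OmissionSet L zero (suc zero) (suc (suc k)) (suc (suc l)) c0k c0l c1k c1l 𝒪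
          × (∀ b → InO L G (𝒪 b))
          × BasedOn L zero (suc zero) (suc (suc k)) (suc (suc l)) c0k c0l c1k c1l 𝒜)

-- Only the cover property of 𝒜 matters, not its size: choosing one member of 𝒜
-- per colour of C₀₁ gives a colour-indexed cover set in O(G), and an omission
-- set based on a subfamily of 𝒜 is based on 𝒜 itself.
module Submission where

open import Defs
open import Data.Nat using (ℕ; suc; _<_)
open import Data.Fin using (Fin; zero; suc; toℕ; fromℕ<)
open import Data.Fin.Properties using (toℕ<n; toℕ-fromℕ<)
open import Data.Product using (Σ; ∃-syntax; _,_; proj₁; proj₂)
open import Function using (_∘_)
open import Relation.Binary.PropositionalEquality using (subst)

module _ {m : ℕ} (L : Lang m) where
  open Lang L

  coverSet-colourIndexed : ∀ i j {I : Set} (𝒜 : I → FinLGraph L) →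
    CoverSet L i j 𝒜 →
    Σ (Fin (sz i j) → I) λ pick → CoverSet L i j (𝒜 ∘ pick)
  coverSet-colourIndexed i j {I} 𝒜 (monic , cover) =
    pick , (monic ∘ pick) , pick-cover
    where
    pick : Fin (sz i j) → I
    pick c = proj₁ (cover (toℕ c) (toℕ<n c))

    pick-cover : ∀ c → c < sz i j → ∃[ a ] HasEdge L (𝒜 (pick a)) i j c
    pick-cover c c< = fromℕ< c< ,
      subst (HasEdge L (𝒜 (pick (fromℕ< c<))) i j) (toℕ-fromℕ< c<)
            (proj₂ (cover (toℕ (fromℕ< c<)) (toℕ<n (fromℕ< c<))))

  basedOn-∘ : ∀ {i j k l cik cil cjk cjl} {I I′ : Set}
    (𝒜 : I → FinLGraph L) (f : I′ → I) →
    BasedOn L i j k l cik cil cjk cjl (𝒜 ∘ f) →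
    BasedOn L i j k l cik cil cjk cjl 𝒜
  basedOn-∘ _ f ((a , edges) , (a′ , edges′)) = (f a , edges) , (f a′ , edges′)

hasOmission-∘ : ∀ {m′} {L : Lang (suc (suc m′))} (G : LGraph L)
  {I I′ : Set} (𝒜 : I → FinLGraph L) (f : I′ → I) →
  HasOmission L G (𝒜 ∘ f) → HasOmission L G 𝒜
hasOmission-∘ {L = L} _ 𝒜 f (k , l , k≢l , c0k , c0l , c1k , c1l , J , 𝒪 , omission , inO , based) =
  k , l , k≢l , c0k , c0l , c1k , c1l , J , 𝒪 , omission , inO , basedOn-∘ L 𝒜 f based

lemma6p4 : ∀ {m' : ℕ} (L : Lang (suc (suc m'))) (G : LGraph L) →
    Homogeneous L G → Generic L G →
    (∀ (𝒜 : Fin (Lang.sz L zero (suc zero)) → FinLGraph L) →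
       CoverSet L zero (suc zero) 𝒜 → (∀ a → InO L G (𝒜 a)) →
       HasOmission L G 𝒜) →
    ∀ (I : Set) (𝒜 : I → FinLGraph L) →
      CoverSet L zero (suc zero) 𝒜 → (∀ a → InO L G (𝒜 a)) →
      HasOmission L G 𝒜
lemma6p4 L G _ _ omission-for-Λ I 𝒜 cover 𝒜⊆O
  with coverSet-colourIndexed L zero (suc zero) 𝒜 cover
... | pick , pick-cover =
  hasOmission-∘ G 𝒜 pick (omission-for-Λ (𝒜 ∘ pick) pick-cover (𝒜⊆O ∘ pick))
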